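{- For every fixed integer $k \ge 2$ and every integer $n \ge 3^k$, $\mathrm{indsat}(n,K_{1,k+1}) = 0$.
   Context: All graphs are finite and simple. A trigraph $T$ consists of a finite vertex set $V(T)$ together with a partition of the set of unordered pairs of distinct vertices of $V(T)$ into black edges, white edges and gray edges. A realization of $T$ is a graph with vertex set $V(T)$ whose edge set consists of all black edges together with some subset of the gray edges. For a graph $H$, a trigraph $T$ is $H$-induced-saturated if no realization of $T$ contains an induced subgraph isomorphic to $H$, but for every black or white edge $e$ of $T$, the trigraph obtained from $T$ by changing $e$ to gray has a realization containing an induced subgraph isomorphic to $H$. The induced saturation number $\mathrm{indsat}(n,H)$ is the minimum number of gray edges in an $H$-induced-saturated trigraph on $n$ vertices. -}

module Defs where

open import Data.Nat using (ℕ; zero; suc; _≤_)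
open import Data.Fin using (Fin; zero; suc; _<?_)
open import Data.Fin.Properties using (_≟_)
open import Data.Bool using (Bool; true; false; if_then_else_; _∧_; _∨_)
open import Data.List using (List; length; filter; allFin; cartesianProduct)
open import Data.Product using (Σ; _×_; _,_; proj₁; proj₂)
open import Relation.Binary.PropositionalEquality using (_≡_; _≢_; refl)
open import Relation.Nullary using (Dec; yes; no; ¬_)
open import Relation.Nullary.Decidable using (⌊_⌋; _×-dec_)
open import Function.Definitions using (Injective)

record Graph (n : ℕ) : Set where
  field
    adj    : Fin n → Fin n → Bool
    sym    : ∀ u v → adj u v ≡ adj v u
    irrefl : ∀ u → adj u u ≡ false
open Graph public

starAdj : ∀ {r} → Fin (suc r) → Fin (suc r) → Bool
starAdj zero    zero    = false
starAdj zero    (suc _) = true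
starAdj (suc _) zero    = true
starAdj (suc _) (suc _) = false

star : (r : ℕ) → Graph (suc r)
star r = record { adj = starAdj ; sym = s ; irrefl = i }
  where
  s : ∀ u v → starAdj u v ≡ starAdj v u
  s zero zero = refl
  s zero (suc _) = refl
  s (suc _) zero = refl
  s (suc _) (suc _) = refl
  i : ∀ u → starAdj u u ≡ false
  i zero = refl
  i (suc _) = refl

data Colour : Set where
  black white gray : Colour

_≟c_ : (a b : Colour) → Dec (a ≡ b)
black ≟c black = yes refl
black ≟c white = no (λ ())
black ≟c gray  = no (λ ())
white ≟c black = no (λ ())
white ≟c white = yes refl
white ≟c gray  = no (λ ())
gray  ≟c black = no (λ ())
gray  ≟c white = no (λ ())
gray  ≟c gray  = yes refl

-- A trigraph on vertex set Fin n is given by a colouring function c;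
-- the colour of the unordered pair {u,v} (u ≠ v) is  colour T u v,
-- which reads c at the pair ordered increasingly.  (Values of c at
-- pairs (x , y) with y ≤ x are ignored.)  Thus every unordered pair of
-- distinct vertices gets exactly one of black / white / gray.
Trigraph : ℕ → Set
Trigraph n = Fin n → Fin n → Colour

colour : ∀ {n} → Trigraph n → Fin n → Fin n → Colour
colour T u v with u <? v
... | yes _ = T u v
... | no  _ = T v u

IsRealization : ∀ {n} → Trigraph n → Graph n → Set
IsRealization T G =
  ∀ u v → u ≢ v →
    (colour T u v ≡ black → adj G u v ≡ true) ×
    (colour T u v ≡ white → adj G u v ≡ false)

HasInduced : ∀ {m n} → Graph n → Graph m → Set
HasInduced {m} {n} G H =
  Σ (Fin m → Fin n) λ f → Injective _≡_ _≡_ f ×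
    (∀ a b → adj G (f a) (f b) ≡ adj H a b)

RealizesInduced : ∀ {m n} → Trigraph n → Graph m → Set
RealizesInduced {m} {n} T H = Σ (Graph n) λ G → IsRealization T G × HasInduced G H

makeGray : ∀ {n} → Trigraph n → Fin n → Fin n → Trigraph n
makeGray T u v x y =
  if ⌊ (x ≟ u) ×-dec (y ≟ v) ⌋ ∨ ⌊ (x ≟ v) ×-dec (y ≟ u) ⌋
  then gray else T x y

IndSaturated : ∀ {m n} → Graph m → Trigraph n → Set
IndSaturated {m} {n} H T =
  (¬ RealizesInduced T H) ×
  (∀ u v → u ≢ v → colour T u v ≢ gray →
     RealizesInduced (makeGray T u v) H)

grayCount : ∀ {n} → Trigraph n → ℕ
grayCount {n} T =
  length (filter (λ p → (proj₁ p <? proj₂ p) ×-dec (colour T (proj₁ p) (proj₂ p) ≟c gray))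
                 (cartesianProduct (allFin n) (allFin n)))

IndsatIs : ∀ {m} → ℕ → Graph m → ℕ → Set
IndsatIs n H s =
  Σ (Trigraph n) (λ T → IndSaturated H T × grayCount T ≡ s) ×
  (∀ (T : Trigraph n) → IndSaturated H T → s ≤ grayCount T)

-- Give the vertices words of {0,1,2}^k, all vertices beyond the first 3^k
-- carrying the zero word, and join two vertices iff their words differ in at
-- most one coordinate.  Read as a trigraph without gray pairs, this graph is
-- K_{1,k+1}-induced-saturated.  It has no induced K_{1,k+1}: each leaf differs
-- from the centre in exactly one coordinate, so by pigeonhole two leaves differ
-- from it in the same coordinate and are adjacent.  Toggling a pair {u,v}
-- creates one.  If u, v were adjacent, agreeing off a coordinate i₀, a third
-- symbol at i₀ of u's word gives a common neighbour w, and u, v together with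
-- the k − 1 words obtained from w by changing one other coordinate are k + 1
-- leaves at w.  If u, v were non-adjacent, v together with the k words obtained
-- from u's word by putting at one coordinate a symbol differing from both u and
-- v are k + 1 leaves at u.

module Submission where

open import Defs renaming (sym to adj-sym; irrefl to adj-irrefl)
open import Data.Bool using (Bool; true; false; not; _∧_; _∨_; _xor_; if_then_else_)
open import Data.Bool.Properties using (∧-comm; ∨-comm)
open import Data.Empty using (⊥-elim)
open import Data.Fin using (Fin; zero; suc; toℕ; fromℕ<; inject≤; punchIn; finToFun; funToFin; _<?_)
open import Data.Fin.Properties
  using (_≟_; any?; pigeonhole; <⇒≢; toℕ-injective; toℕ-inject≤; toℕ-fromℕ<; toℕ<n;
         punchInᵢ≢i; punchIn-injective; finToFun-funToFin; suc-injective)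
open import Data.List using (length; allFin; cartesianProduct)
open import Data.List.Properties using (filter-none)
open import Data.List.Relation.Unary.All using (universal)
open import Data.Nat using (ℕ; zero; suc; _≤_; _+_; _^_; z≤n)
import Data.Nat as ℕ
open import Data.Nat.Properties using (n<1+n; +-comm)
open import Data.Product using (∃; _×_; _,_; proj₁; proj₂)
open import Data.Vec using (Vec; lookup; tabulate; replicate; _[_]≔_)
open import Data.Vec.Properties using (lookup∘update; lookup∘update′; tabulate-cong; tabulate∘lookup)
open import Function using (_∘_)
open import Function.Definitions using (Injective)
open import Relation.Binary.PropositionalEquality
open import Relation.Nullary using (Dec; yes; no; ¬_; does)
open import Relation.Nullary.Decidable using (⌊_⌋; _×-dec_; ¬?; map′; dec-true; dec-false; isYes≗does)

private
  variable
    k m n : ℕ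

colourOf : Bool → Colour
colourOf true  = black
colourOf false = white

colourOf≢gray : ∀ b → colourOf b ≢ gray
colourOf≢gray true  ()
colourOf≢gray false ()

colourOf≡black : ∀ {b} → colourOf b ≡ black → b ≡ true
colourOf≡black {true}  _ = refl
colourOf≡black {false} ()

colourOf≡white : ∀ {b} → colourOf b ≡ white → b ≡ false
colourOf≡white {false} _ = refl
colourOf≡white {true}  ()

toTrigraph : Graph n → Trigraph n
toTrigraph G x y = colourOf (adj G x y)

colour-toTrigraph : (G : Graph n) (x y : Fin n) → colour (toTrigraph G) x y ≡ colourOf (adj G x y)
colour-toTrigraph G x y with x <? y
... | yes _ = refl
... | no  _ = cong colourOf (adj-sym G y x)

grayCount-toTrigraph : (G : Graph n) → grayCount (toTrigraph G) ≡ 0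
grayCount-toTrigraph {n} G = cong length (filter-none isGray? {xs = cartesianProduct (allFin n) (allFin n)} (universal notGray _))
  where
  isGray? = λ (p : Fin n × Fin n) → (proj₁ p <? proj₂ p) ×-dec (colour (toTrigraph G) (proj₁ p) (proj₂ p) ≟c gray)
  notGray : ∀ p → ¬ (proj₁ p Data.Fin.< proj₂ p × colour (toTrigraph G) (proj₁ p) (proj₂ p) ≡ gray)
  notGray (x , y) (_ , isGray) = colourOf≢gray (adj G x y) (trans (sym (colour-toTrigraph G x y)) isGray)

realization-agrees : {G G′ : Graph n} → IsRealization (toTrigraph G) G′ →
                     ∀ x y → x ≢ y → adj G′ x y ≡ adj G x y
realization-agrees {G = G} realizes x y x≢y with adj G x y in e
... | true  = proj₁ (realizes x y x≢y) (trans (colour-toTrigraph G x y) (cong colourOf e))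
... | false = proj₂ (realizes x y x≢y) (trans (colour-toTrigraph G x y) (cong colourOf e))

hasInduced-transfer : {G G′ : Graph n} {H : Graph m} → (∀ x y → x ≢ y → adj G′ x y ≡ adj G x y) →
                      HasInduced G′ H → HasInduced G H
hasInduced-transfer {G = G} {H = H} agree (f , f-injective , f-adj) = f , f-injective , adj-f
  where
  adj-f : ∀ a b → adj G (f a) (f b) ≡ adj H a b
  adj-f a b with a ≟ b
  ... | yes refl = trans (adj-irrefl G (f a)) (sym (adj-irrefl H a))
  ... | no  a≢b  = trans (sym (agree (f a) (f b) (a≢b ∘ f-injective))) (f-adj a b)

isPair : Fin n → Fin n → Fin n → Fin n → Bool
isPair u v x y = ⌊ (x ≟ u) ×-dec (y ≟ v) ⌋ ∨ ⌊ (x ≟ v) ×-dec (y ≟ u) ⌋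

isPair-sym : (u v x y : Fin n) → isPair u v x y ≡ isPair u v y x
isPair-sym u v x y = begin
  isPair u v x y
    ≡⟨ cong₂ _∨_ (isYes≗does ((x ≟ u) ×-dec (y ≟ v))) (isYes≗does ((x ≟ v) ×-dec (y ≟ u))) ⟩
  (does (x ≟ u) ∧ does (y ≟ v)) ∨ (does (x ≟ v) ∧ does (y ≟ u))
    ≡⟨ ∨-comm (does (x ≟ u) ∧ does (y ≟ v)) _ ⟩
  (does (x ≟ v) ∧ does (y ≟ u)) ∨ (does (x ≟ u) ∧ does (y ≟ v))
    ≡⟨ cong₂ _∨_ (∧-comm (does (x ≟ v)) _) (∧-comm (does (x ≟ u)) _) ⟩
  (does (y ≟ u) ∧ does (x ≟ v)) ∨ (does (y ≟ v) ∧ does (x ≟ u))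
    ≡⟨ sym (cong₂ _∨_ (isYes≗does ((y ≟ u) ×-dec (x ≟ v))) (isYes≗does ((y ≟ v) ×-dec (x ≟ u)))) ⟩
  isPair u v y x ∎
  where open ≡-Reasoning

isPair-uv : (u v : Fin n) → isPair u v u v ≡ true
isPair-uv u v = cong (_∨ ⌊ (u ≟ v) ×-dec (v ≟ u) ⌋)
  (trans (isYes≗does ((u ≟ u) ×-dec (v ≟ v))) (dec-true ((u ≟ u) ×-dec (v ≟ v)) (refl , refl)))

isPair-false : {u v x y : Fin n} → ¬ (x ≡ u × y ≡ v) → ¬ (x ≡ v × y ≡ u) → isPair u v x y ≡ false
isPair-false {u = u} {v} {x} {y} ¬uv ¬vu = cong₂ _∨_
  (trans (isYes≗does ((x ≟ u) ×-dec (y ≟ v))) (dec-false ((x ≟ u) ×-dec (y ≟ v)) ¬uv))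
  (trans (isYes≗does ((x ≟ v) ×-dec (y ≟ u))) (dec-false ((x ≟ v) ×-dec (y ≟ u)) ¬vu))

isPair-outside : {u v x y : Fin n} → x ≢ u → x ≢ v → isPair u v x y ≡ false
isPair-outside x≢u x≢v = isPair-false (x≢u ∘ proj₁) (x≢v ∘ proj₁)

toggle : (G : Graph n) (u v : Fin n) → u ≢ v → Graph n
toggle G u v u≢v = record
  { adj    = λ x y → isPair u v x y xor adj G x y
  ; sym    = λ x y → cong₂ _xor_ (isPair-sym u v x y) (adj-sym G x y)
  ; irrefl = λ x → cong₂ _xor_ (isPair-false {x = x} {y = x} (λ (x≡u , x≡v) → u≢v (trans (sym x≡u) x≡v))
                                             (λ (x≡v , x≡u) → u≢v (trans (sym x≡u) x≡v)))
                               (adj-irrefl G x)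
  }

colour-makeGray : (G : Graph n) (u v x y : Fin n) →
                  colour (makeGray (toTrigraph G) u v) x y ≡ (if isPair u v x y then gray else colourOf (adj G x y))
colour-makeGray G u v x y with x <? y
... | yes _ = refl
... | no  _ = cong₂ (λ b c → if b then gray else colourOf c) (isPair-sym u v y x) (adj-sym G y x)

toggle-realizes : (G : Graph n) {u v : Fin n} (u≢v : u ≢ v) →
                  IsRealization (makeGray (toTrigraph G) u v) (toggle G u v u≢v)
toggle-realizes G {u} {v} u≢v x y _ rewrite colour-makeGray G u v x y = realizes (isPair u v x y) (adj G x y)
  where
  realizes : ∀ p b → ((if p then gray else colourOf b) ≡ black → p xor b ≡ true) ×
                     ((if p then gray else colourOf b) ≡ white → p xor b ≡ false)
  realizes true  _ = (λ ()) , (λ ())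
  realizes false b = colourOf≡black {b} , colourOf≡white {b}

indsat≡0 : {H : Graph m} (G : Graph n) → ¬ HasInduced G H →
           (∀ u v (u≢v : u ≢ v) → HasInduced (toggle G u v u≢v) H) → IndsatIs n H 0
indsat≡0 {H = H} G H-free toggled = (toTrigraph G , (noRealization , saturated) , grayCount-toTrigraph G) , λ _ _ → z≤n
  where
  noRealization : ¬ RealizesInduced (toTrigraph G) H
  noRealization (G′ , realizes , induced) =
    H-free (hasInduced-transfer {G = G} {G′} {H} (realization-agrees {G = G} {G′} realizes) induced)
  saturated : ∀ u v → u ≢ v → colour (toTrigraph G) u v ≢ gray → RealizesInduced (makeGray (toTrigraph G) u v) H
  saturated u v u≢v _ = toggle G u v u≢v , toggle-realizes G u≢v , toggled u v u≢v

record InducedStar (G : Graph n) (m : ℕ) : Set where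
  field
    centre         : Fin n
    leaf           : Fin m → Fin n
    centre-adj     : ∀ a → adj G centre (leaf a) ≡ true
    leaves-nonadj  : ∀ a b → a ≢ b → adj G (leaf a) (leaf b) ≡ false
    leaf-injective : Injective _≡_ _≡_ leaf

hasInducedStar : {G : Graph n} → InducedStar G m → HasInduced G (star m)
hasInducedStar {n} {m} {G} S = f , f-injective , f-adj
  where
  open InducedStar S
  f : Fin (suc m) → Fin n
  f zero    = centre
  f (suc a) = leaf a
  centre≢leaf : ∀ a → centre ≢ leaf a
  centre≢leaf a e with () ← trans (sym (centre-adj a)) (trans (cong (λ c → adj G c (leaf a)) e) (adj-irrefl G (leaf a)))
  f-injective : Injective _≡_ _≡_ f
  f-injective {zero}  {zero}  _ = refl
  f-injective {zero}  {suc b} e = ⊥-elim (centre≢leaf b e)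
  f-injective {suc a} {zero}  e = ⊥-elim (centre≢leaf a (sym e))
  f-injective {suc a} {suc b} e = cong suc (leaf-injective e)
  f-adj : ∀ a b → adj G (f a) (f b) ≡ starAdj a b
  f-adj zero    zero    = adj-irrefl G centre
  f-adj zero    (suc b) = centre-adj b
  f-adj (suc a) zero    = trans (adj-sym G (leaf a) centre) (centre-adj a)
  f-adj (suc a) (suc b) with a ≟ b
  ... | yes refl = adj-irrefl G (leaf a)
  ... | no  a≢b  = leaves-nonadj a b a≢b

addLeaf : {G : Graph n} (S : InducedStar G m) (x : Fin n) → adj G (InducedStar.centre S) x ≡ true →
          (∀ a → adj G x (InducedStar.leaf S a) ≡ false) → (∀ a → x ≢ InducedStar.leaf S a) → InducedStar G (suc m)
addLeaf {n} {m} {G} S x centre-x x-nonadj x≢leaf = record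
  { centre = centre ; leaf = leaf′ ; centre-adj = centre-adj′
  ; leaves-nonadj = leaves-nonadj′ ; leaf-injective = leaf′-injective
  }
  where
  open InducedStar S
  leaf′ : Fin (suc m) → Fin n
  leaf′ zero    = x
  leaf′ (suc a) = leaf a
  centre-adj′ : ∀ a → adj G centre (leaf′ a) ≡ true
  centre-adj′ zero    = centre-x
  centre-adj′ (suc a) = centre-adj a
  leaves-nonadj′ : ∀ a b → a ≢ b → adj G (leaf′ a) (leaf′ b) ≡ false
  leaves-nonadj′ zero    zero    a≢b = ⊥-elim (a≢b refl)
  leaves-nonadj′ zero    (suc b) _   = x-nonadj b
  leaves-nonadj′ (suc a) zero    _   = trans (adj-sym G (leaf a) x) (x-nonadj a)
  leaves-nonadj′ (suc a) (suc b) a≢b = leaves-nonadj a b (a≢b ∘ cong suc)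
  leaf′-injective : Injective _≡_ _≡_ leaf′
  leaf′-injective {zero}  {zero}  _ = refl
  leaf′-injective {zero}  {suc b} e = ⊥-elim (x≢leaf b e)
  leaf′-injective {suc a} {zero}  e = ⊥-elim (x≢leaf a (sym e))
  leaf′-injective {suc a} {suc b} e = cong suc (leaf-injective e)

-- Ternary words and Hamming distance

Word : ℕ → Set
Word = Vec (Fin 3)

record Apart (x y : Word k) : Set where
  constructor apartAt
  field
    {i j}   : Fin k
    i≢j     : i ≢ j
    differᵢ : lookup x i ≢ lookup y i
    differⱼ : lookup x j ≢ lookup y j

apart? : (x y : Word k) → Dec (Apart x y)
apart? x y = map′ (λ (_ , _ , i≢j , dᵢ , dⱼ) → apartAt i≢j dᵢ dⱼ)
                  (λ (apartAt i≢j dᵢ dⱼ) → _ , _ , i≢j , dᵢ , dⱼ)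
  (any? λ i → any? λ j → ¬? (i ≟ j) ×-dec ¬? (lookup x i ≟ lookup y i) ×-dec ¬? (lookup x j ≟ lookup y j))

apart-sym : {x y : Word k} → Apart x y → Apart y x
apart-sym (apartAt i≢j dᵢ dⱼ) = apartAt i≢j (dᵢ ∘ sym) (dⱼ ∘ sym)

apart⇒≢ : {x y : Word k} → Apart x y → x ≢ y
apart⇒≢ (apartAt _ dᵢ _) refl = dᵢ refl

AgreeOff : Fin k → Word k → Word k → Set
AgreeOff i x y = ∀ j → j ≢ i → lookup x j ≡ lookup y j

agreeOff⇒¬apart : {i : Fin k} {x y : Word k} → AgreeOff i x y → ¬ Apart x y
agreeOff⇒¬apart {i = i} agree (apartAt {i₁} {j₁} i₁≢j₁ d₁ d₂) with i₁ ≟ i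
... | yes refl = d₂ (agree j₁ (i₁≢j₁ ∘ sym))
... | no  i₁≢i = d₁ (agree i₁ i₁≢i)

¬apart⇒agreeOff : {i : Fin k} {x y : Word k} → ¬ Apart x y → lookup x i ≢ lookup y i → AgreeOff i x y
¬apart⇒agreeOff {x = x} {y} ¬xy xᵢ≢yᵢ j j≢i with lookup x j ≟ lookup y j
... | yes xⱼ≡yⱼ = xⱼ≡yⱼ
... | no  xⱼ≢yⱼ = ⊥-elim (¬xy (apartAt (j≢i ∘ sym) xᵢ≢yᵢ xⱼ≢yⱼ))

apart⇒differsOff : {x y : Word k} → Apart x y → ∀ i → ∃ λ j → j ≢ i × lookup x j ≢ lookup y j
apart⇒differsOff (apartAt {i₁} {j₁} i₁≢j₁ d₁ d₂) i with i₁ ≟ i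
... | yes refl = j₁ , i₁≢j₁ ∘ sym , d₂
... | no  i₁≢i = i₁ , i₁≢i , d₁

¬apart⇒agreeOffSome : {x y : Word (suc k)} → ¬ Apart x y → ∃ λ i → AgreeOff i x y
¬apart⇒agreeOffSome {x = x} {y} ¬xy with any? (λ i → ¬? (lookup x i ≟ lookup y i))
... | yes (i , xᵢ≢yᵢ) = i , ¬apart⇒agreeOff ¬xy xᵢ≢yᵢ
... | no  ¬differs    = zero , λ j _ → equal j
  where
  equal : ∀ j → lookup x j ≡ lookup y j
  equal j with lookup x j ≟ lookup y j
  ... | yes xⱼ≡yⱼ = xⱼ≡yⱼ
  ... | no  xⱼ≢yⱼ = ⊥-elim (¬differs (j , xⱼ≢yⱼ))

record DiffersOnlyAt (i : Fin k) (x y : Word k) : Set where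
  constructor differsOnlyAt
  field
    differs : lookup x i ≢ lookup y i
    agrees  : AgreeOff i x y

Neighbours : Word k → Word k → Set
Neighbours x y = ∃ λ i → DiffersOnlyAt i x y

neighbours-sym : {x y : Word k} → Neighbours x y → Neighbours y x
neighbours-sym (i , differsOnlyAt xᵢ≢yᵢ agree) = i , differsOnlyAt (xᵢ≢yᵢ ∘ sym) (λ j j≢i → sym (agree j j≢i))

neighbours⇒¬apart : {x y : Word k} → Neighbours x y → ¬ Apart x y
neighbours⇒¬apart (_ , differsOnlyAt _ agree) = agreeOff⇒¬apart agree

neighbours⇒≢ : {x y : Word k} → Neighbours x y → x ≢ y
neighbours⇒≢ (_ , differsOnlyAt xᵢ≢xᵢ _) refl = xᵢ≢xᵢ refl

differsOnlyAt-update : (x : Word k) (i : Fin k) {a : Fin 3} → a ≢ lookup x i → DiffersOnlyAt i x (x [ i ]≔ a)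
differsOnlyAt-update x i {a} a≢xᵢ = differsOnlyAt
  (λ e → a≢xᵢ (sym (trans e (lookup∘update i x a))))
  (λ j j≢i → sym (lookup∘update′ j≢i x a))

apart-update₂ : (x : Word k) {i j : Fin k} {a b : Fin 3} → i ≢ j → a ≢ lookup x i → b ≢ lookup x j →
                Apart (x [ i ]≔ a) (x [ j ]≔ b)
apart-update₂ x {i} {j} {a} {b} i≢j a≢xᵢ b≢xⱼ = apartAt i≢j
  (λ e → a≢xᵢ (trans (sym (lookup∘update i x a)) (trans e (lookup∘update′ i≢j x b))))
  (λ e → b≢xⱼ (sym (trans (sym (lookup∘update′ (i≢j ∘ sym) x a)) (trans e (lookup∘update j x b)))))

apart-update-of-apart : {x y : Word k} {i : Fin k} {a : Fin 3} → Apart x y → a ≢ lookup y i → Apart (x [ i ]≔ a) y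
apart-update-of-apart {x = x} {y} {i} {a} xy a≢yᵢ with apart⇒differsOff xy i
... | j , j≢i , xⱼ≢yⱼ = apartAt (j≢i ∘ sym)
  (λ e → a≢yᵢ (trans (sym (lookup∘update i x a)) e))
  (λ e → xⱼ≢yⱼ (trans (sym (lookup∘update′ j≢i x a)) e))

apart-update-of-neighbour : {x y : Word k} {i j : Fin k} {a : Fin 3} → DiffersOnlyAt i x y → j ≢ i →
                            a ≢ lookup y j → Apart (y [ j ]≔ a) x
apart-update-of-neighbour {x = x} {y} {i} {j} {a} (differsOnlyAt xᵢ≢yᵢ agree) j≢i a≢yⱼ = apartAt (j≢i ∘ sym)
  (λ e → xᵢ≢yᵢ (sym (trans (sym (lookup∘update′ (j≢i ∘ sym) y a)) e)))
  (λ e → a≢yⱼ (trans (sym (lookup∘update j y a)) (trans e (agree j j≢i))))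

neighbour-of-apart : {x y z : Word k} → ¬ Apart x y → ¬ Apart x z → Apart y z → Neighbours x y
neighbour-of-apart {x = x} {y} ¬xy ¬xz (apartAt {i} {j} i≢j yᵢ≢zᵢ yⱼ≢zⱼ)
  with lookup x i ≟ lookup y i | lookup x j ≟ lookup y j
... | no xᵢ≢yᵢ  | _         = i , differsOnlyAt xᵢ≢yᵢ (¬apart⇒agreeOff ¬xy xᵢ≢yᵢ)
... | yes _     | no xⱼ≢yⱼ  = j , differsOnlyAt xⱼ≢yⱼ (¬apart⇒agreeOff ¬xy xⱼ≢yⱼ)
... | yes xᵢ≡yᵢ | yes xⱼ≡yⱼ =
  ⊥-elim (¬xz (apartAt i≢j (yᵢ≢zᵢ ∘ trans (sym xᵢ≡yᵢ)) (yⱼ≢zⱼ ∘ trans (sym xⱼ≡yⱼ))))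

neighbours-not-pairwise-apart : (x : Word k) (ys : Fin (suc k) → Word k) → (∀ a → Neighbours x (ys a)) →
                                ¬ (∀ a b → a ≢ b → Apart (ys a) (ys b))
neighbours-not-pairwise-apart {k} x ys neighbours apart with pigeonhole (n<1+n k) (proj₁ ∘ neighbours)
... | a , b , a<b , same-coordinate = agreeOff⇒¬apart agree (apart a b (<⇒≢ a<b))
  where
  agree : AgreeOff (proj₁ (neighbours a)) (ys a) (ys b)
  agree j j≢i = trans (sym (DiffersOnlyAt.agrees (proj₂ (neighbours a)) j j≢i))
                      (DiffersOnlyAt.agrees (proj₂ (neighbours b)) j (λ e → j≢i (trans e (sym same-coordinate))))

near : Word k → Word k → Bool
near x y = not (does (apart? x y))

near-true : {x y : Word k} → ¬ Apart x y → near x y ≡ true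
near-true {x = x} {y} ¬xy = cong not (dec-false (apart? x y) ¬xy)

near-false : {x y : Word k} → Apart x y → near x y ≡ false
near-false {x = x} {y} xy = cong not (dec-true (apart? x y) xy)

near-sym : (x y : Word k) → near x y ≡ near y x
near-sym x y with apart? x y
... | yes xy  = trans (near-false xy) (sym (near-false (apart-sym xy)))
... | no  ¬xy = trans (near-true ¬xy) (sym (near-true (¬xy ∘ apart-sym)))

near-true⁻¹ : {x y : Word k} → near x y ≡ true → ¬ Apart x y
near-true⁻¹ isNear xy with () ← trans (sym isNear) (near-false xy)

near-false⁻¹ : {x y : Word k} → near x y ≡ false → Apart x y
near-false⁻¹ {x = x} {y} notNear with apart? x y
... | yes xy  = xy
... | no  ¬xy with () ← trans (sym notNear) (near-true ¬xy)

-- The Hamming graph blown up along a word labelling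

hammingGraph : (Fin n → Word k) → Graph n
hammingGraph code = record
  { adj    = λ p q → not (does (p ≟ q)) ∧ near (code p) (code q)
  ; sym    = λ p q → cong₂ (λ b c → not b ∧ c) (≟-sym p q) (near-sym (code p) (code q))
  ; irrefl = λ p → cong (λ b → not b ∧ near (code p) (code p)) (dec-true (p ≟ p) refl)
  }
  where
  ≟-sym : (p q : Fin _) → does (p ≟ q) ≡ does (q ≟ p)
  ≟-sym p q with p ≟ q | q ≟ p
  ... | yes _   | yes _   = refl
  ... | no  _   | no  _   = refl
  ... | yes p≡q | no  q≢p = ⊥-elim (q≢p (sym p≡q))
  ... | no  p≢q | yes q≡p = ⊥-elim (p≢q (sym q≡p))

adj-hammingGraph : (code : Fin n → Word k) {p q : Fin n} → p ≢ q → adj (hammingGraph code) p q ≡ near (code p) (code q)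
adj-hammingGraph code {p} {q} p≢q = cong (λ b → not b ∧ near (code p) (code q)) (dec-false (p ≟ q) p≢q)

hammingGraph-starFree : (code : Fin n → Word (suc k)) → ¬ HasInduced (hammingGraph code) (star (suc (suc k)))
hammingGraph-starFree {k = k} code (f , f-injective , f-adj) =
  neighbours-not-pairwise-apart (code (f zero)) leafWord neighbours apart
  where
  leafWord : Fin (suc (suc k)) → Word (suc k)
  leafWord a = code (f (suc a))
  centre≢leaf : ∀ a → f zero ≢ f (suc a)
  centre≢leaf a e with () ← f-injective e
  ¬apart : ∀ a → ¬ Apart (code (f zero)) (leafWord a)
  ¬apart a = near-true⁻¹ (trans (sym (adj-hammingGraph code (centre≢leaf a))) (f-adj zero (suc a)))
  apart : ∀ a b → a ≢ b → Apart (leafWord a) (leafWord b)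
  apart a b a≢b =
    near-false⁻¹ (trans (sym (adj-hammingGraph code (a≢b ∘ suc-injective ∘ f-injective))) (f-adj (suc a) (suc b)))
  another : (a : Fin (suc (suc k))) → ∃ λ b → a ≢ b
  another zero    = suc zero , λ ()
  another (suc _) = zero , λ ()
  neighbours : ∀ a → Neighbours (code (f zero)) (leafWord a)
  neighbours a = let b , a≢b = another a in neighbour-of-apart (¬apart a) (¬apart b) (apart a b a≢b)

third : (a b : Fin 3) → ∃ λ c → c ≢ a × c ≢ b
third zero             zero             = suc zero       , (λ ()) , (λ ())
third zero             (suc zero)       = suc (suc zero) , (λ ()) , (λ ())
third zero             (suc (suc zero)) = suc zero       , (λ ()) , (λ ())
third (suc zero)       zero             = suc (suc zero) , (λ ()) , (λ ())
third (suc zero)       (suc zero)       = zero           , (λ ()) , (λ ())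
third (suc zero)       (suc (suc zero)) = zero           , (λ ()) , (λ ())
third (suc (suc zero)) zero             = suc zero       , (λ ()) , (λ ())
third (suc (suc zero)) (suc zero)       = zero           , (λ ()) , (λ ())
third (suc (suc zero)) (suc (suc zero)) = zero           , (λ ()) , (λ ())

module ToggledHammingGraph {n k : ℕ} (code : Fin n → Word (suc k)) (vertex : Word (suc k) → Fin n)
                           (code-vertex : ∀ w → code (vertex w) ≡ w) {u v : Fin n} (u≢v : u ≢ v) where

  G G′ : Graph n
  G  = hammingGraph code
  G′ = toggle G u v u≢v

  vertex-injective : {w w′ : Word (suc k)} → vertex w ≡ vertex w′ → w ≡ w′
  vertex-injective {w} {w′} e = trans (sym (code-vertex w)) (trans (cong code e) (code-vertex w′))

  vertex-≢ : {w : Word (suc k)} {p : Fin n} → w ≢ code p → vertex w ≢ p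
  vertex-≢ {w} w≢p e = w≢p (trans (sym (code-vertex w)) (cong code e))

  adj′-uv : adj G′ u v ≡ not (near (code u) (code v))
  adj′-uv = trans (cong (_xor adj G u v) (isPair-uv u v)) (cong not (adj-hammingGraph code u≢v))

  adj′-vertex : {w : Word (suc k)} {p : Fin n} → w ≢ code u → w ≢ code v → w ≢ code p →
                adj G′ (vertex w) p ≡ near w (code p)
  adj′-vertex {w} {p} w≢u w≢v w≢p = begin
    isPair u v (vertex w) p xor adj G (vertex w) p
      ≡⟨ cong (_xor adj G (vertex w) p) (isPair-outside (vertex-≢ w≢u) (vertex-≢ w≢v)) ⟩
    adj G (vertex w) p
      ≡⟨ adj-hammingGraph code (vertex-≢ w≢p) ⟩
    near (code (vertex w)) (code p)
      ≡⟨ cong (λ c → near c (code p)) (code-vertex w) ⟩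
    near w (code p) ∎
    where open ≡-Reasoning

  adj′-neighbour : {w : Word (suc k)} {p : Fin n} → w ≢ code u → w ≢ code v → Neighbours w (code p) →
                   adj G′ (vertex w) p ≡ true
  adj′-neighbour w≢u w≢v wp = trans (adj′-vertex w≢u w≢v (neighbours⇒≢ wp)) (near-true (neighbours⇒¬apart wp))

  adj′-apart : {w : Word (suc k)} {p : Fin n} → w ≢ code u → w ≢ code v → Apart w (code p) →
               adj G′ (vertex w) p ≡ false
  adj′-apart w≢u w≢v wp = trans (adj′-vertex w≢u w≢v (apart⇒≢ wp)) (near-false wp)

  starAt : (c : Fin n) (ys : Fin m → Word (suc k)) → (∀ a → ys a ≢ code u) → (∀ a → ys a ≢ code v) →
           (∀ a → Neighbours (code c) (ys a)) → (∀ a b → a ≢ b → Apart (ys a) (ys b)) → InducedStar G′ m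
  starAt c ys ys≢u ys≢v neighbours apart = record
    { centre         = c
    ; leaf           = vertex ∘ ys
    ; centre-adj     = λ a → trans (adj-sym G′ c (vertex (ys a)))
                                   (adj′-neighbour (ys≢u a) (ys≢v a) (neighbours-sym (neighbours a)))
    ; leaves-nonadj  = λ a b a≢b →
        adj′-apart (ys≢u a) (ys≢v a) (subst (Apart (ys a)) (sym (code-vertex (ys b))) (apart a b a≢b))
    ; leaf-injective = leaf-injective
    }
    where
    leaf-injective : Injective _≡_ _≡_ (vertex ∘ ys)
    leaf-injective {a} {b} e with a ≟ b
    ... | yes a≡b = a≡b
    ... | no  a≢b = ⊥-elim (apart⇒≢ (apart a b a≢b) (vertex-injective e))

  starAfterJoining : Apart (code u) (code v) → InducedStar G′ (suc (suc k))
  starAfterJoining uv = addLeaf (starAt u zs zs≢u zs≢v neighbours apart) v u-v v-zs v≢zs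
    where
    t : Fin (suc k) → Fin 3
    t j = proj₁ (third (lookup (code u) j) (lookup (code v) j))
    t≢u : ∀ j → t j ≢ lookup (code u) j
    t≢u j = proj₁ (proj₂ (third (lookup (code u) j) (lookup (code v) j)))
    t≢v : ∀ j → t j ≢ lookup (code v) j
    t≢v j = proj₂ (proj₂ (third (lookup (code u) j) (lookup (code v) j)))
    zs : Fin (suc k) → Word (suc k)
    zs j = code u [ j ]≔ t j
    neighbours : ∀ j → Neighbours (code u) (zs j)
    neighbours j = j , differsOnlyAt-update (code u) j (t≢u j)
    apart : ∀ j j′ → j ≢ j′ → Apart (zs j) (zs j′)
    apart j j′ j≢j′ = apart-update₂ (code u) j≢j′ (t≢u j) (t≢u j′)
    zs-apart-v : ∀ j → Apart (zs j) (code v)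
    zs-apart-v j = apart-update-of-apart uv (t≢v j)
    zs≢u : ∀ j → zs j ≢ code u
    zs≢u j = neighbours⇒≢ (neighbours-sym (neighbours j))
    zs≢v : ∀ j → zs j ≢ code v
    zs≢v j = apart⇒≢ (zs-apart-v j)
    u-v : adj G′ u v ≡ true
    u-v = trans adj′-uv (cong not (near-false uv))
    v-zs : ∀ j → adj G′ v (vertex (zs j)) ≡ false
    v-zs j = trans (adj-sym G′ v (vertex (zs j))) (adj′-apart (zs≢u j) (zs≢v j) (zs-apart-v j))
    v≢zs : ∀ j → v ≢ vertex (zs j)
    v≢zs j = vertex-≢ (zs≢v j) ∘ sym

  starAfterSeparating : ¬ Apart (code u) (code v) → InducedStar G′ (suc (suc k))
  starAfterSeparating ¬uv = addLeaf starWithV u z-u u-leaf u≢leaf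
    where
    i₀ : Fin (suc k)
    i₀ = proj₁ (¬apart⇒agreeOffSome ¬uv)
    t : Fin 3
    t = proj₁ (third (lookup (code u) i₀) (lookup (code v) i₀))
    t≢u : t ≢ lookup (code u) i₀
    t≢u = proj₁ (proj₂ (third (lookup (code u) i₀) (lookup (code v) i₀)))
    t≢v : t ≢ lookup (code v) i₀
    t≢v = proj₂ (proj₂ (third (lookup (code u) i₀) (lookup (code v) i₀)))
    z : Word (suc k)
    z = code u [ i₀ ]≔ t
    u~z : DiffersOnlyAt i₀ (code u) z
    u~z = differsOnlyAt-update (code u) i₀ t≢u
    v~z : DiffersOnlyAt i₀ (code v) z
    v~z = differsOnlyAt
      (λ e → t≢v (sym (trans e (lookup∘update i₀ (code u) t))))
      (λ j j≢i₀ → trans (sym (proj₂ (¬apart⇒agreeOffSome ¬uv) j j≢i₀)) (DiffersOnlyAt.agrees u~z j j≢i₀))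
    z≢u : z ≢ code u
    z≢u = neighbours⇒≢ (neighbours-sym (i₀ , u~z))
    z≢v : z ≢ code v
    z≢v = neighbours⇒≢ (neighbours-sym (i₀ , v~z))
    p : Fin k → Fin (suc k)
    p = punchIn i₀
    s : Fin k → Fin 3
    s j = proj₁ (third (lookup z (p j)) (lookup z (p j)))
    s≢z : ∀ j → s j ≢ lookup z (p j)
    s≢z j = proj₁ (proj₂ (third (lookup z (p j)) (lookup z (p j))))
    ys : Fin k → Word (suc k)
    ys j = z [ p j ]≔ s j
    neighbours : ∀ j → Neighbours (code (vertex z)) (ys j)
    neighbours j = subst (λ w → Neighbours w (ys j)) (sym (code-vertex z)) (p j , differsOnlyAt-update z (p j) (s≢z j))
    apart : ∀ j j′ → j ≢ j′ → Apart (ys j) (ys j′)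
    apart j j′ j≢j′ = apart-update₂ z (j≢j′ ∘ punchIn-injective i₀ j j′) (s≢z j) (s≢z j′)
    ys-apart-u : ∀ j → Apart (ys j) (code u)
    ys-apart-u j = apart-update-of-neighbour u~z (punchInᵢ≢i i₀ j) (s≢z j)
    ys-apart-v : ∀ j → Apart (ys j) (code v)
    ys-apart-v j = apart-update-of-neighbour v~z (punchInᵢ≢i i₀ j) (s≢z j)
    ys≢u : ∀ j → ys j ≢ code u
    ys≢u j = apart⇒≢ (ys-apart-u j)
    ys≢v : ∀ j → ys j ≢ code v
    ys≢v j = apart⇒≢ (ys-apart-v j)
    z-v : adj G′ (vertex z) v ≡ true
    z-v = adj′-neighbour z≢u z≢v (neighbours-sym (i₀ , v~z))
    v-ys : ∀ j → adj G′ v (vertex (ys j)) ≡ false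
    v-ys j = trans (adj-sym G′ v (vertex (ys j))) (adj′-apart (ys≢u j) (ys≢v j) (ys-apart-v j))
    v≢ys : ∀ j → v ≢ vertex (ys j)
    v≢ys j = vertex-≢ (ys≢v j) ∘ sym
    starWithV : InducedStar G′ (suc k)
    starWithV = addLeaf (starAt (vertex z) ys ys≢u ys≢v neighbours apart) v z-v v-ys v≢ys
    z-u : adj G′ (vertex z) u ≡ true
    z-u = adj′-neighbour z≢u z≢v (neighbours-sym (i₀ , u~z))
    u-leaf : ∀ a → adj G′ u (InducedStar.leaf starWithV a) ≡ false
    u-leaf zero    = trans adj′-uv (cong not (near-true ¬uv))
    u-leaf (suc j) = trans (adj-sym G′ u (vertex (ys j))) (adj′-apart (ys≢u j) (ys≢v j) (ys-apart-u j))
    u≢leaf : ∀ a → u ≢ InducedStar.leaf starWithV a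
    u≢leaf zero    = u≢v
    u≢leaf (suc j) = vertex-≢ (ys≢u j) ∘ sym

  toggle-hasStar : HasInduced G′ (star (suc (suc k)))
  toggle-hasStar with apart? (code u) (code v)
  ... | yes uv  = hasInducedStar (starAfterJoining uv)
  ... | no  ¬uv = hasInducedStar (starAfterSeparating ¬uv)

wordCode : 3 ^ k ≤ n → Fin n → Word k
wordCode {k} _ p with toℕ p ℕ.<? 3 ^ k
... | yes p<3^k = tabulate (finToFun (fromℕ< p<3^k))
... | no  _     = replicate k zero

wordVertex : 3 ^ k ≤ n → Word k → Fin n
wordVertex 3^k≤n w = inject≤ (funToFin (lookup w)) 3^k≤n

wordCode-wordVertex : (3^k≤n : 3 ^ k ≤ n) (w : Word k) → wordCode 3^k≤n (wordVertex 3^k≤n w) ≡ w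
wordCode-wordVertex {k} 3^k≤n w with toℕ (wordVertex 3^k≤n w) ℕ.<? 3 ^ k
... | yes p<3^k = begin
  tabulate (finToFun (fromℕ< p<3^k))           ≡⟨ cong (tabulate ∘ finToFun) fromℕ<≡funToFin ⟩
  tabulate (finToFun (funToFin (lookup w)))   ≡⟨ tabulate-cong (finToFun-funToFin (lookup w)) ⟩
  tabulate (lookup w)                         ≡⟨ tabulate∘lookup w ⟩
  w                                           ∎
  where
  open ≡-Reasoning
  fromℕ<≡funToFin : fromℕ< p<3^k ≡ funToFin (lookup w)
  fromℕ<≡funToFin = toℕ-injective (trans (toℕ-fromℕ< p<3^k) (toℕ-inject≤ (funToFin (lookup w)) 3^k≤n))
... | no p≮3^k =
  ⊥-elim (p≮3^k (subst (ℕ._< 3 ^ k) (sym (toℕ-inject≤ (funToFin (lookup w)) 3^k≤n)) (toℕ<n (funToFin (lookup w)))))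

indsat-star≡0 : ∀ k n → 3 ^ suc k ≤ n → IndsatIs n (star (suc (suc k))) 0
indsat-star≡0 k n 3^[1+k]≤n = indsat≡0 {H = star (suc (suc k))} (hammingGraph code) (hammingGraph-starFree code)
  λ u v u≢v → ToggledHammingGraph.toggle-hasStar code (wordVertex 3^[1+k]≤n) (wordCode-wordVertex 3^[1+k]≤n) u≢v
  where
  code : Fin n → Word (suc k)
  code = wordCode 3^[1+k]≤n

corollary3p3 : (k : ℕ) → 2 ≤ k → (n : ℕ) → 3 ^ k ≤ n →
    IndsatIs n (star (k + 1)) 0
corollary3p3 zero    () _ _
corollary3p3 (suc k) _  n 3^k≤n = subst (λ r → IndsatIs n (star r) 0) (+-comm 1 (suc k)) (indsat-star≡0 k n 3^k≤n)
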